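{- In any bi-flock chicken graph, either there exists a 1-Duke, or there exist (at least) four distinct 3-Dukes.
   Context: A bi-flock chicken graph is a finite orientation of a complete bipartite graph; vertices are chickens, the two partite sets are flocks, and "$c$ pecks $d$" means the edge is oriented from $c$ to $d$. A peck chain of length $m$ is a directed path with $m$ edges. A chicken $d$ is an $m$-Duke if every chicken not in the flock of $d$ can be reached from $d$ by a peck chain of length at most $m$ (so a 1-Duke pecks every chicken outside its own flock). -}

module Defs where

open import Data.Nat using (ℕ; zero; suc; _≤_)
open import Data.Fin using (Fin)
open import Data.Bool using (Bool; true; false)
open import Data.Sum using (_⊎_; inj₁; inj₂)
open import Data.Product using (∃-syntax; _×_)
open import Data.Empty using (⊥)
open import Relation.Binary.PropositionalEquality using (_≡_)

-- A bi-flock chicken graph: an orientation of the complete bipartite graph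
-- K_{m,n}. Flock A = Fin m, flock B = Fin n.
-- orient a b ≡ true  means  a pecks b;  orient a b ≡ false  means  b pecks a.
record BiFlock (m n : ℕ) : Set where
  field
    orient : Fin m → Fin n → Bool

Chicken : ℕ → ℕ → Set
Chicken m n = Fin m ⊎ Fin n

flockOf : ∀ {m n} → Chicken m n → Bool
flockOf (inj₁ _) = true
flockOf (inj₂ _) = false

Pecks : ∀ {m n} → BiFlock m n → Chicken m n → Chicken m n → Set
Pecks G (inj₁ a) (inj₂ b) = BiFlock.orient G a b ≡ true
Pecks G (inj₂ b) (inj₁ a) = BiFlock.orient G a b ≡ false
Pecks G (inj₁ _) (inj₁ _) = ⊥
Pecks G (inj₂ _) (inj₂ _) = ⊥

data PeckChain {m n} (G : BiFlock m n) : ℕ → Chicken m n → Chicken m n → Set where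
  here : ∀ {c} → PeckChain G zero c c
  step : ∀ {k c e d} → Pecks G c e → PeckChain G k e d → PeckChain G (suc k) c d

IsDuke : ∀ {m n} → BiFlock m n → ℕ → Chicken m n → Set
IsDuke G k d = ∀ c → (flockOf c ≡ flockOf d → ⊥) →
  ∃[ j ] (j ≤ k × PeckChain G j d c)

-- Compare the chickens of one flock by inclusion of the sets they peck. When
-- there is no 1-Duke, every chicken a whose set is maximal is a 3-Duke: a
-- chicken b it does not peck is pecked by some a″, and maximality yields a b′
-- pecked by a but not by a″, giving the chain a → b′ → a″ → b. Two distinct
-- maximal chickens exist: one above an arbitrary chicken, and one above a
-- chicken pecking some b that the first one misses. Reversing every edge
-- exchanges the flocks, giving two more 3-Dukes in the other flock.
module Submission where

open import Defs
open import Data.Nat using (ℕ; suc; s≤s; z≤n)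
open import Data.Nat.Properties using (≤-refl)
open import Data.Fin using (Fin; zero)
open import Data.Fin.Properties using (any?; all?; ¬∀⟶∃¬)
open import Data.Fin.Subset using (Subset; _∈_; _∉_; _⊆_; _⊂_; _⊃_)
open import Data.Fin.Subset.Properties using (_∈?_; _⊂?_; ⊆-refl; ⊆-trans)
open import Data.Fin.Subset.Induction using (Acc; acc; ⊃-wellFounded)
open import Data.Vec using (tabulate)
open import Data.Vec.Properties using (lookup∘tabulate; lookup⇒[]=; []=⇒lookup)
open import Data.Bool using (not)
open import Data.Bool.Properties using (not-injective; ¬-not)
open import Data.Sum using (_⊎_; inj₁; inj₂; swap)
open import Data.Sum.Properties using (swap-involutive; inj₁-injective; inj₂-injective)
open import Data.Product using (∃-syntax; _×_; _,_; proj₁)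
open import Function using (_∘_; const)
open import Relation.Nullary using (¬_; ¬?; yes; no; contradiction)
open import Relation.Nullary.Decidable using (decidable-stable; _→-dec_)
open import Relation.Binary.PropositionalEquality using (_≡_; _≢_; refl; sym; trans; subst)

private
  variable
    m n k : ℕ

⊈⇒∃∈∉ : {p q : Subset n} → ¬ (p ⊆ q) → ∃[ x ] (x ∈ p × x ∉ q)
⊈⇒∃∈∉ {n} {p} {q} p⊈q with ¬∀⟶∃¬ n (λ x → x ∈ p → x ∈ q) (λ x → x ∈? p →-dec x ∈? q) (λ p⊆q → p⊈q (p⊆q _))
... | x , x∈p⇏x∈q =
  x , decidable-stable (x ∈? p) (λ x∉p → x∈p⇏x∈q (λ x∈p → contradiction x∈p x∉p)) , x∈p⇏x∈q ∘ const

out : BiFlock m n → Fin m → Subset n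
out G a = tabulate (BiFlock.orient G a)

module _ (G : BiFlock m n) where

  open BiFlock G

  ∈-out⇒pecks : ∀ {a b} → b ∈ out G a → Pecks G (inj₁ a) (inj₂ b)
  ∈-out⇒pecks {a} {b} b∈ = trans (sym (lookup∘tabulate (orient a) b)) ([]=⇒lookup b∈)

  pecks⇒∈-out : ∀ {a b} → Pecks G (inj₁ a) (inj₂ b) → b ∈ out G a
  pecks⇒∈-out {a} {b} p = lookup⇒[]= b (out G a) (trans (lookup∘tabulate (orient a) b) p)

  ∉-out⇒pecked : ∀ {a b} → b ∉ out G a → Pecks G (inj₂ b) (inj₁ a)
  ∉-out⇒pecked b∉ = ¬-not (b∉ ∘ pecks⇒∈-out)

  Maximal : Fin m → Set
  Maximal a = ∀ a′ → ¬ (out G a ⊂ out G a′)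

  maximal-above : ∀ a → ∃[ a′ ] (out G a ⊆ out G a′ × Maximal a′)
  maximal-above a = go a (⊃-wellFounded (out G a))
    where
    go : ∀ a → Acc _⊃_ (out G a) → ∃[ a′ ] (out G a ⊆ out G a′ × Maximal a′)
    go a (acc rec) with any? (λ a′ → out G a ⊂? out G a′)
    ... | no ¬bigger = a , ⊆-refl , λ a′ a⊂a′ → ¬bigger (a′ , a⊂a′)
    ... | yes (a′ , a⊂a′) with go a′ (rec a⊂a′)
    ...   | a″ , a′⊆a″ , max = a″ , ⊆-trans (proj₁ a⊂a′) a′⊆a″ , max

  maximal⇒3-Duke : ∀ {a} → Maximal a → (∀ b → ∃[ a′ ] b ∈ out G a′) → IsDuke G 3 (inj₁ a)
  maximal⇒3-Duke max pecked (inj₁ _) ≢flock = contradiction refl ≢flock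
  maximal⇒3-Duke {a} max pecked (inj₂ b) _ with b ∈? out G a
  ... | yes b∈a = 1 , s≤s z≤n , step (∈-out⇒pecks b∈a) here
  ... | no b∉a with pecked b
  ...   | a″ , b∈a″ with ⊈⇒∃∈∉ (λ a⊆a″ → max a″ (a⊆a″ , b , b∈a″ , b∉a))
  ...     | b′ , b′∈a , b′∉a″ =
    3 , ≤-refl , step {e = inj₂ b′} (∈-out⇒pecks b′∈a)
                   (step {e = inj₁ a″} (∉-out⇒pecked b′∉a″)
                   (step (∈-out⇒pecks b∈a″) here))

  two-3-Dukes : (∀ a → ∃[ b ] b ∉ out G a) → (∀ b → ∃[ a ] b ∈ out G a) → Fin m →
    ∃[ a₁ ] ∃[ a₂ ] (a₁ ≢ a₂ × IsDuke G 3 (inj₁ a₁) × IsDuke G 3 (inj₁ a₂))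
  two-3-Dukes misses pecked a₀ with maximal-above a₀
  ... | a₁ , _ , max₁ with misses a₁
  ...   | b , b∉a₁ with pecked b
  ...     | a , b∈a with maximal-above a
  ...       | a₂ , a⊆a₂ , max₂ =
    a₁ , a₂ , (λ { refl → b∉a₁ (a⊆a₂ b∈a) }) , maximal⇒3-Duke max₁ pecked , maximal⇒3-Duke max₂ pecked

  1-Duke-or-two-3-Dukes : Fin m →
    (∃[ d ] IsDuke G 1 d) ⊎ (∃[ a₁ ] ∃[ a₂ ] (a₁ ≢ a₂ × IsDuke G 3 (inj₁ a₁) × IsDuke G 3 (inj₁ a₂)))
  1-Duke-or-two-3-Dukes a₀ with any? (λ a → all? (λ b → b ∈? out G a))
  ... | yes (a , ⊆a) = inj₁ (inj₁ a , pecksAll⇒1-Duke)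
    where
    pecksAll⇒1-Duke : IsDuke G 1 (inj₁ a)
    pecksAll⇒1-Duke (inj₁ _) ≢flock = contradiction refl ≢flock
    pecksAll⇒1-Duke (inj₂ b) _ = 1 , ≤-refl , step (∈-out⇒pecks (⊆a b)) here
  ... | no ¬∃⊆a with any? (λ b → all? (λ a → ¬? (b ∈? out G a)))
  ...   | yes (b , ∉a) = inj₁ (inj₂ b , peckedByNone⇒1-Duke)
    where
    peckedByNone⇒1-Duke : IsDuke G 1 (inj₂ b)
    peckedByNone⇒1-Duke (inj₂ _) ≢flock = contradiction refl ≢flock
    peckedByNone⇒1-Duke (inj₁ a) _ = 1 , ≤-refl , step (∉-out⇒pecked (∉a a)) here
  ...   | no ¬∃∉a = inj₂ (two-3-Dukes misses pecked a₀)
    where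
    misses : ∀ a → ∃[ b ] b ∉ out G a
    misses a = ¬∀⟶∃¬ _ _ (_∈? out G a) (¬∃⊆a ∘ (a ,_))
    pecked : ∀ b → ∃[ a ] b ∈ out G a
    pecked b with ¬∀⟶∃¬ _ _ (λ a → ¬? (b ∈? out G a)) (¬∃∉a ∘ (b ,_))
    ... | a , ¬b∉a = a , decidable-stable (b ∈? out G a) ¬b∉a

transpose : BiFlock m n → BiFlock n m
transpose G = record { orient = λ b a → not (BiFlock.orient G a b) }

module _ (G : BiFlock m n) where

  transpose-Pecks : ∀ {c d} → Pecks (transpose G) c d → Pecks G (swap c) (swap d)
  transpose-Pecks {inj₁ _} {inj₂ _} = not-injective
  transpose-Pecks {inj₂ _} {inj₁ _} = not-injective

  transpose-PeckChain : ∀ {c d} → PeckChain (transpose G) k c d → PeckChain G k (swap c) (swap d)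
  transpose-PeckChain here = here
  transpose-PeckChain (step p ch) = step (transpose-Pecks p) (transpose-PeckChain ch)

  transpose-IsDuke : ∀ {d} → IsDuke (transpose G) k d → IsDuke G k (swap d)
  transpose-IsDuke {d = d} duke c ≢flock with duke (swap c) (≢flock ∘ flockOf-swap c d)
    where
    flockOf-swap : ∀ c d → flockOf (swap c) ≡ flockOf d → flockOf c ≡ flockOf (swap d)
    flockOf-swap (inj₁ _) (inj₂ _) _ = refl
    flockOf-swap (inj₂ _) (inj₁ _) _ = refl
  ... | j , j≤k , ch = j , j≤k , subst (PeckChain G j (swap d)) (swap-involutive c) (transpose-PeckChain ch)

theorem1 : (m n : ℕ) → (G : BiFlock (suc m) (suc n)) →
    (∃[ d ] IsDuke G 1 d)
    ⊎ (∃[ d₁ ] ∃[ d₂ ] ∃[ d₃ ] ∃[ d₄ ]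
        (d₁ ≢ d₂ × d₁ ≢ d₃ × d₁ ≢ d₄ × d₂ ≢ d₃ × d₂ ≢ d₄ × d₃ ≢ d₄ ×
         IsDuke G 3 d₁ × IsDuke G 3 d₂ × IsDuke G 3 d₃ × IsDuke G 3 d₄))
theorem1 m n G with 1-Duke-or-two-3-Dukes G zero | 1-Duke-or-two-3-Dukes (transpose G) zero
... | inj₁ duke | _ = inj₁ duke
... | inj₂ _ | inj₁ (d , duke) = inj₁ (swap d , transpose-IsDuke G duke)
... | inj₂ (a₁ , a₂ , a₁≢a₂ , duke₁ , duke₂) | inj₂ (b₁ , b₂ , b₁≢b₂ , duke₃ , duke₄) =
  inj₂ (inj₁ a₁ , inj₁ a₂ , inj₂ b₁ , inj₂ b₂ ,
        a₁≢a₂ ∘ inj₁-injective , (λ ()) , (λ ()) , (λ ()) , (λ ()) , b₁≢b₂ ∘ inj₂-injective ,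
        duke₁ , duke₂ , transpose-IsDuke G duke₃ , transpose-IsDuke G duke₄)
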